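{- Let $n\ge 2$ and $r\ge 1$ be integers with $r+1\leq\binom{n}{2}$. Then $t_{r+1}(K_n)\leq t_r(K_n)$.
   Context: An $r$-edge-coloring of a graph $G$ is an assignment of one of $r$ colors to each edge such that each of the $r$ colors appears on at least one edge. A heterochromatic tree is an edge-colored tree in which any two edges have different colors; a single vertex counts as a heterochromatic tree. For an $r$-edge-coloring $\phi$ of $G$, $t_r(G,\phi)$ is the minimum number of vertex-disjoint heterochromatic trees needed to cover all vertices of $G$, and $t_r(G)=\max_\phi t_r(G,\phi)$ over all $r$-edge-colorings $\phi$ of $G$. -}

module Defs where

open import Data.Nat using (ℕ; zero; suc; _≤_)
open import Data.Nat.Combinatorics using (_C_)
open import Data.Fin using (Fin; zero; suc; inject₁; fromℕ)
open import Data.Bool using (Bool; true)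
open import Data.Product using (Σ; ∃; ∃-syntax; _×_; _,_)
open import Data.Sum using (_⊎_)
open import Data.Empty using (⊥)
open import Relation.Binary.PropositionalEquality using (_≡_; _≢_)
open import Relation.Binary.Construct.Closure.ReflexiveTransitive using (Star)
open import Function.Definitions using (Injective; Surjective)

-- The complete graph K_n has vertex set Fin n; its edges are the unordered
-- pairs {i,j} with i ≢ j.

-- An r-edge-coloring of K_n: a symmetric assignment c i j of a colour in
-- Fin r to every pair (values on the diagonal i ≡ j are irrelevant junk),
-- such that every colour occurs on some edge.
record EdgeColoring (r n : ℕ) : Set where
  field
    col     : Fin n → Fin n → Fin r
    col-sym : ∀ i j → col i j ≡ col j i
    col-all : ∀ (k : Fin r) → ∃[ i ] ∃[ j ] (i ≢ j × col i j ≡ k)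

SameEdge : ∀ {n} → Fin n → Fin n → Fin n → Fin n → Set
SameEdge i j i' j' = (i ≡ i' × j ≡ j') ⊎ (i ≡ j' × j ≡ i')

-- A subgraph of K_n given by its (symmetric, loopless) edge set.
Adj : ℕ → Set
Adj n = Fin n → Fin n → Bool

HasCycle : ∀ {n} → Adj n → Set
HasCycle {n} S =
  ∃[ m ] Σ (Fin (suc (suc (suc m))) → Fin n) λ g →
    Injective _≡_ _≡_ g ×
    (∀ (i : Fin (suc (suc m))) → S (g (inject₁ i)) (g (suc i)) ≡ true) ×
    S (g (fromℕ (suc (suc m)))) (g zero) ≡ true

-- A partition of the vertices of K_n into k vertex-disjoint heterochromatic
-- trees (w.r.t. colouring c).  `part v` is the index of the tree containing v;
-- S is the union of the tree edge sets.
record HetTreeCover {r n : ℕ} (φ : EdgeColoring r n) (k : ℕ) : Set where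
  open EdgeColoring φ
  field
    part      : Fin n → Fin k
    part-surj : Surjective _≡_ _≡_ part
    S         : Adj n
    S-sym     : ∀ i j → S i j ≡ S j i
    S-loop    : ∀ i j → S i j ≡ true → i ≢ j
    S-inside  : ∀ i j → S i j ≡ true → part i ≡ part j
    connected : ∀ u v → part u ≡ part v → Star (λ a b → S a b ≡ true) u v
    acyclic   : HasCycle S → ⊥
    hetero    : ∀ i j i' j' → S i j ≡ true → S i' j' ≡ true →
                part i ≡ part i' → col i j ≡ col i' j' → SameEdge i j i' j'

IsTφ : ∀ {r n : ℕ} → EdgeColoring r n → ℕ → Set
IsTφ φ k = HetTreeCover φ k × (∀ (j : ℕ) → HetTreeCover φ j → k ≤ j)

IsT : ℕ → ℕ → ℕ → Set
IsT r n t =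
  (∀ (φ : EdgeColoring r n) (k : ℕ) → IsTφ φ k → k ≤ t) ×
  (Σ (EdgeColoring r n) λ φ → IsTφ φ t)

module Submission where

-- Let φ be an (r+1)-edge-colouring of K_n with t_{r+1}(K_n, φ)
-- = t_{r+1}(K_n).  Merging the last colour of φ into the previous one gives
-- an r-edge-colouring ψ (no colour class becomes empty).  Merging colours
-- only identifies colours, so every heterochromatic tree cover for ψ is one
-- for φ; hence t_{r+1}(K_n) = t(φ) ≤ t(ψ) ≤ t_r(K_n).
--
-- Since
-- covers need not be decidable, t(ψ) exists only classically: we show that
-- a least cover size exists up to double negation (some cover exists, the
-- one by singletons), which suffices because the goal a ≤ b is decidable.

open import Defs
open import Data.Nat using (ℕ; suc; _≤_; _<_; _≤?_; s≤s; z≤n)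
open import Data.Nat.Combinatorics using (_C_)
open import Data.Nat.Properties using (≤-trans; ≰⇒>)
open import Data.Nat.Induction using (<-rec)
open import Data.Fin using (Fin; zero; suc; inject₁)
open import Data.Bool using (false)
open import Data.Product using (Σ; _×_; _,_)
open import Data.Empty using (⊥-elim)
open import Relation.Nullary using (¬_; yes; no)
open import Relation.Nullary.Decidable using (decidable-stable)
open import Relation.Binary.PropositionalEquality using (_≡_; refl; cong; trans)
open import Relation.Binary.Construct.Closure.ReflexiveTransitive using (ε)

recolour : ∀ {r s n} (f : Fin r → Fin s) (g : Fin s → Fin r) →
           (∀ k → f (g k) ≡ k) → EdgeColoring r n → EdgeColoring s n
recolour f g fg φ = record
  { col     = λ i j → f (col i j)
  ; col-sym = λ i j → cong f (col-sym i j)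
  ; col-all = λ k → let (i , j , i≢j , colij≡gk) = col-all (g k)
                    in i , j , i≢j , trans (cong f colij≡gk) (fg k)
  }
  where open EdgeColoring φ

-- Recolouring can only identify colours, so a tree that is heterochromatic
-- after recolouring was already heterochromatic: covers pull back.
pullback-cover : ∀ {r s n} (f : Fin r → Fin s) (g : Fin s → Fin r)
                 (fg : ∀ k → f (g k) ≡ k) (φ : EdgeColoring r n) {k : ℕ} →
                 HetTreeCover (recolour f g fg φ) k → HetTreeCover φ k
pullback-cover f g fg φ c = record
  { part = part ; part-surj = part-surj ; S = S ; S-sym = S-sym
  ; S-loop = S-loop ; S-inside = S-inside ; connected = connected
  ; acyclic = acyclic
  ; hetero = λ i j i' j' ij∈S i'j'∈S same-tree same-col →
      hetero i j i' j' ij∈S i'j'∈S same-tree (cong f same-col)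
  }
  where open HetTreeCover c

mergeTop : ∀ {m} → Fin (suc (suc m)) → Fin (suc m)
mergeTop zero             = zero
mergeTop {ℕ.zero} (suc _) = zero
mergeTop {suc m}  (suc i) = suc (mergeTop i)

mergeTop-inject₁ : ∀ {m} (k : Fin (suc m)) → mergeTop (inject₁ k) ≡ k
mergeTop-inject₁ zero            = refl
mergeTop-inject₁ {suc m} (suc k) = cong suc (mergeTop-inject₁ k)

mergeColours : ∀ {m n} → EdgeColoring (suc (suc m)) n → EdgeColoring (suc m) n
mergeColours = recolour mergeTop inject₁ mergeTop-inject₁

singletons : ∀ {r n} (φ : EdgeColoring r n) → HetTreeCover φ n
singletons φ = record
  { part = λ v → v ; part-surj = λ v → v , λ eq → eq
  ; S = λ _ _ → false ; S-sym = λ _ _ → refl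
  ; S-loop = λ _ _ () ; S-inside = λ _ _ ()
  ; connected = λ { u .u refl → ε }
  ; acyclic = λ { (_ , _ , _ , _ , ()) }
  ; hetero = λ _ _ _ _ () }

¬¬-least : (P : ℕ → Set) (j : ℕ) → P j →
           ¬ ¬ (Σ ℕ λ k → P k × (∀ j' → P j' → k ≤ j'))
¬¬-least P = <-rec (λ j → P j → ¬ ¬ Least) search
  where
  Least : Set
  Least = Σ ℕ λ k → P k × (∀ j' → P j' → k ≤ j')

  search : ∀ j → (∀ {j'} → j' < j → P j' → ¬ ¬ Least) → P j → ¬ ¬ Least
  search j below Pj noLeast = noLeast (j , Pj , j-least)
    where
    j-least : ∀ j' → P j' → j ≤ j'
    j-least j' Pj' with j ≤? j'
    ... | yes j≤j' = j≤j'
    ... | no  j≰j' = ⊥-elim (below (≰⇒> j≰j') Pj' noLeast)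

¬¬-tφ : ∀ {r n} (ψ : EdgeColoring r n) → ¬ ¬ (Σ ℕ λ k → IsTφ ψ k)
¬¬-tφ {n = n} ψ = ¬¬-least (HetTreeCover ψ) n (singletons ψ)

tφ-mergeColours : ∀ {m n} (φ : EdgeColoring (suc (suc m)) n) {a k : ℕ} →
                  IsTφ φ a → IsTφ (mergeColours φ) k → a ≤ k
tφ-mergeColours φ {k = k} (_ , a-least) (ψ-cover , _) =
  a-least k (pullback-cover mergeTop inject₁ mergeTop-inject₁ φ ψ-cover)

lemma3 : ∀ (n r : ℕ) → 2 ≤ n → 1 ≤ r → suc r ≤ n C 2 →
    ∀ (a b : ℕ) → IsT (suc r) n a → IsT r n b → a ≤ b
lemma3 n (suc r) _ (s≤s z≤n) _ a b (_ , φ , tφ≡a) (b-max , _) =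
  decidable-stable (a ≤? b) λ a≰b →
    ¬¬-tφ ψ λ { (k , tψ≡k) →
      a≰b (≤-trans (tφ-mergeColours φ tφ≡a tψ≡k) (b-max ψ k tψ≡k)) }
  where
  ψ : EdgeColoring (suc r) n
  ψ = mergeColours φ
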